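{- Let $X$ be a non-empty $n$-element set. Let $\hat 0_l\in\Pi_l(X)$ be the labelled set partition into $n$ unlabelled singletons, $\sigma_n\in\Pi_l(X)$ the labelled set partition into $n$ labelled singletons $\{x,l\}$, and $\hat 1_l=\{X\cup\{l\}\}$. Then \[ \mu_{\Pi_l(X)}(\sigma_n,\hat 1_l)=(-1)^{n-1}(n-1)!,\qquad \mu_{\Pi_l(X)}(\hat 0_l,\hat 1_l)=(-1)^n(n-1)!. \]
   Context: For a finite set $X$ and a symbol $l\notin X$, a labelled set partition of $X$ is a collection $\pi=\{B_1\cup L_1,\dots,B_k\cup L_k\}$ where $\{B_1,\dots,B_k\}$ is a set partition of $X$ and each $L_i\in\{\emptyset,\{l\}\}$ (labelled block if $L_i=\{l\}$, unlabelled otherwise). $\Pi_l(X)$ is the set of all such, partially ordered by $\sigma\le\pi$ iff every block of $\sigma$ (as a set, including $l$ if present) is contained in some block of $\pi$. $\mu_{\Pi_l(X)}$ is its Möbius function: $\mu(x,x)=1$, $\sum_{x\le z\le y}\mu(x,z)=0$ for $x<y$, $\mu(x,y)=0$ if $x\not\le y$. -}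

module Defs where

open import Data.Bool using (Bool; true; false; _∧_; _∨_; not; _xor_; T)
open import Data.Nat using (ℕ; zero; suc)
open import Data.Fin using (Fin) renaming (_≟_ to _≟ᶠ_)
open import Data.Vec using (Vec; []; _∷_; lookup; tabulate)
open import Data.List using (List; []; _∷_; map; concatMap; filterᵇ; foldr; allFin; cartesianProduct)
open import Data.Product using (_×_; _,_; proj₁; proj₂)
open import Data.Integer using (ℤ; _+_; 0ℤ; 1ℤ)
open import Relation.Nullary using (¬_; ⌊_⌋)
open import Relation.Binary.PropositionalEquality using (_≡_; _≢_)

-- A labelled set partition of X = Fin n is encoded by
--   * an n×n Boolean matrix R, R i j = true  iff  i and j lie in the same block,
--   * a Boolean vector L,   L i = true  iff  the block containing i is labelled.
-- Such raw data represents a labelled set partition iff R is an equivalence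
-- relation and L is constant on the blocks (this encoding is a bijection).
Raw : ℕ → Set
Raw n = Vec (Vec Bool n) n × Vec Bool n

rel : ∀ {n} → Raw n → Fin n → Fin n → Bool
rel r i j = lookup (lookup (proj₁ r) i) j

lab : ∀ {n} → Raw n → Fin n → Bool
lab r i = lookup (proj₂ r) i

_⇒ᵇ_ : Bool → Bool → Bool
a ⇒ᵇ b = not a ∨ b

_⇔ᵇ_ : Bool → Bool → Bool
a ⇔ᵇ b = not (a xor b)

∀ᶠ : ∀ {n} → (Fin n → Bool) → Bool
∀ᶠ {n} p = foldr (λ i b → p i ∧ b) true (allFin n)

valid : ∀ {n} → Raw n → Bool
valid r =
  ∀ᶠ (λ i → rel r i i)
  ∧ ∀ᶠ (λ i → ∀ᶠ (λ j → rel r i j ⇔ᵇ rel r j i))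
  ∧ ∀ᶠ (λ i → ∀ᶠ (λ j → ∀ᶠ (λ k → (rel r i j ∧ rel r j k) ⇒ᵇ rel r i k)))
  ∧ ∀ᶠ (λ i → ∀ᶠ (λ j → rel r i j ⇒ᵇ (lab r i ⇔ᵇ lab r j)))

-- σ ≤ π iff every block of σ (including l if labelled) lies in a block of π:
-- same σ-block ⇒ same π-block, and a labelled σ-block lies in a labelled π-block.
_≤ᵇ_ : ∀ {n} → Raw n → Raw n → Bool
σ ≤ᵇ π = ∀ᶠ (λ i → ∀ᶠ (λ j → rel σ i j ⇒ᵇ rel π i j))
         ∧ ∀ᶠ (λ i → lab σ i ⇒ᵇ lab π i)

_≤ₗ_ : ∀ {n} → Raw n → Raw n → Set
σ ≤ₗ π = T (σ ≤ᵇ π)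

allVec : ∀ {A : Set} → List A → (n : ℕ) → List (Vec A n)
allVec xs zero = [] ∷ []
allVec xs (suc n) = concatMap (λ x → map (x ∷_) (allVec xs n)) xs

allRaw : (n : ℕ) → List (Raw n)
allRaw n = cartesianProduct (allVec (allVec (true ∷ false ∷ []) n) n)
                            (allVec (true ∷ false ∷ []) n)

elements : (n : ℕ) → List (Raw n)
elements n = filterᵇ valid (allRaw n)

sumℤ : List ℤ → ℤ
sumℤ = foldr _+_ 0ℤ

intervalSum : ∀ {n} → (Raw n → Raw n → ℤ) → Raw n → Raw n → ℤ
intervalSum {n} μ x y = sumℤ (map (μ x) (filterᵇ (λ z → (x ≤ᵇ z) ∧ (z ≤ᵇ y)) (elements n)))

record IsMöbius {n : ℕ} (μ : Raw n → Raw n → ℤ) : Set where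
  field
    diag : ∀ x → T (valid x) → μ x x ≡ 1ℤ
    sum0 : ∀ x y → T (valid x) → T (valid y) → x ≤ₗ y → x ≢ y → intervalSum μ x y ≡ 0ℤ
    off  : ∀ x y → T (valid x) → T (valid y) → ¬ (x ≤ₗ y) → μ x y ≡ 0ℤ

_==ᶠ_ : ∀ {n} → Fin n → Fin n → Bool
i ==ᶠ j = ⌊ i ≟ᶠ j ⌋

zeroₗ : (n : ℕ) → Raw n
zeroₗ n = tabulate (λ i → tabulate (λ j → i ==ᶠ j)) , tabulate (λ _ → false)

sigmaₗ : (n : ℕ) → Raw n
sigmaₗ n = tabulate (λ i → tabulate (λ j → i ==ᶠ j)) , tabulate (λ _ → true)

oneₗ : (n : ℕ) → Raw n
oneₗ n = tabulate (λ _ → tabulate (λ _ → true)) , tabulate (λ _ → true)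

module Submission where

-- For S ∋ 0 and a label b let block b S have the block S, singletons elsewhere,
-- every block labelled b; σ_n and 0̂_l are block true {0} and block false {0}.
-- By induction on the number k of elements outside S, μ(block b S, 1̂_l) is
-- (-1)^k k! for b = true and (-1)^(k+1) k! for b = false. For k = 0 the interval
-- is a point resp. a two-element chain. For k > 0, Weisner's theorem with the
-- element {S ∪ l, Sᶜ ∪ l} shows μ(block b S, 1̂_l) = -Σ_{r ∉ S} μ(block b (S∪{r}), 1̂_l).

open import Defs
open import Data.Bool using (Bool; true; false; T; _∧_)
open import Data.Nat using (ℕ; zero; suc; _!)
open import Data.Integer using (ℤ; +_; 0ℤ; 1ℤ; -1ℤ; _+_; _*_; -_; _^_)
open import Data.List using (List)
open import Data.List.Membership.Propositional using (_∈_)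
open import Data.List.Relation.Unary.Unique.Propositional using (Unique)
open import Data.Product using (_×_; _,_)
open import Relation.Binary.PropositionalEquality
open import Relation.Binary.Definitions using (DecidableEquality)

module BoolFacts where
  open import Data.Bool using (not)
  open import Data.Bool.Properties using (T-≡)
  open import Data.Unit using (tt)
  open import Data.Empty using (⊥-elim)
  open import Function using (Equivalence)

  T⇒≡ : ∀ {b} → T b → b ≡ true
  T⇒≡ = Equivalence.to T-≡

  ≡⇒T : ∀ {b} → b ≡ true → T b
  ≡⇒T = Equivalence.from T-≡

  ∧-intro : ∀ {a b} → T a → T b → T (a ∧ b)
  ∧-intro {true} {true} _ _ = tt

  ∧-fst : ∀ {a b} → T (a ∧ b) → T a
  ∧-fst {true} _ = tt

  ∧-snd : ∀ {a b} → T (a ∧ b) → T b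
  ∧-snd {true} p = p

  T-ext : ∀ {a b} → (T a → T b) → (T b → T a) → a ≡ b
  T-ext {true}  {true}  f g = refl
  T-ext {true}  {false} f g = ⊥-elim (f tt)
  T-ext {false} {true}  f g = ⊥-elim (g tt)
  T-ext {false} {false} f g = refl

  true≢false : true ≢ false
  true≢false ()

  T-not : ∀ {b} → b ≡ false → T (not b)
  T-not refl = tt

  T-not⁻ : ∀ {b} → T (not b) → b ≡ false
  T-not⁻ {false} _ = refl

open BoolFacts

module Sums where
  open import Data.Bool using (if_then_else_)
  open import Data.Integer.Properties using (+-identityˡ; +-identityʳ; +-comm; *-zeroʳ; *-distribˡ-+)
  open import Data.Integer.Solver using (module +-*-Solver)
  open import Data.Fin as Fin using (Fin)
  open import Data.List using ([]; _∷_; map; filterᵇ; allFin)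
  open import Data.List.Properties using (map-tabulate)
  open import Data.List.Relation.Unary.Any using (here; there)
  open import Data.List.Relation.Unary.All as All using ()
  open import Data.List.Relation.Unary.AllPairs using (_∷_)
  open import Data.Empty using (⊥-elim)
  open import Data.Product using (Σ)
  open import Relation.Nullary using (yes; no; ⌊_⌋)

  private variable
    A B : Set

  ∑ : List A → (A → ℤ) → ℤ
  ∑ L f = sumℤ (map f L)

  -- ind b v is v when b holds and 0 otherwise; it turns filtered sums into full sums.
  ind : Bool → ℤ → ℤ
  ind b v = if b then v else 0ℤ

  ∑-cong : ∀ (L : List A) {f g : A → ℤ} → (∀ {e} → e ∈ L → f e ≡ g e) → ∑ L f ≡ ∑ L g
  ∑-cong []      h = refl
  ∑-cong (x ∷ L) h = cong₂ _+_ (h (here refl)) (∑-cong L (λ p → h (there p)))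

  ∑-zero : ∀ (L : List A) {f : A → ℤ} → (∀ {e} → e ∈ L → f e ≡ 0ℤ) → ∑ L f ≡ 0ℤ
  ∑-zero []      h = refl
  ∑-zero (x ∷ L) h = cong₂ _+_ (h (here refl)) (∑-zero L (λ p → h (there p)))

  ∑-+ : ∀ (L : List A) (f g : A → ℤ) → ∑ L (λ e → f e + g e) ≡ ∑ L f + ∑ L g
  ∑-+ []      f g = refl
  ∑-+ (x ∷ L) f g = trans (cong (λ s → f x + g x + s) (∑-+ L f g)) (interchange (f x) (g x) _ _)
    where
    open +-*-Solver
    interchange : ∀ a b c d → a + b + (c + d) ≡ a + c + (b + d)
    interchange = solve 4 (λ a b c d → a :+ b :+ (c :+ d) := a :+ c :+ (b :+ d)) refl

  ∑-scale : ∀ (L : List A) (c : ℤ) (f : A → ℤ) → ∑ L (λ e → c * f e) ≡ c * ∑ L f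
  ∑-scale []      c f = sym (*-zeroʳ c)
  ∑-scale (x ∷ L) c f = trans (cong (λ s → c * f x + s) (∑-scale L c f)) (sym (*-distribˡ-+ c (f x) _))

  ∑-swap : ∀ (L : List A) (M : List B) (h : A → B → ℤ) →
    ∑ L (λ e → ∑ M (h e)) ≡ ∑ M (λ d → ∑ L (λ e → h e d))
  ∑-swap []      M h = sym (∑-zero M (λ _ → refl))
  ∑-swap (x ∷ L) M h = trans (cong (λ s → ∑ M (h x) + s) (∑-swap L M h))
                             (sym (∑-+ M (h x) (λ d → ∑ L (λ e → h e d))))

  ∑-ind : ∀ (L : List A) (b : Bool) (f : A → ℤ) → ∑ L (λ e → ind b (f e)) ≡ ind b (∑ L f)
  ∑-ind L true  f = refl
  ∑-ind L false f = ∑-zero L (λ _ → refl)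

  ∑-allFin-suc : ∀ {k} (h : Fin (suc k) → ℤ) → ∑ (allFin (suc k)) h ≡ h Fin.zero + ∑ (allFin k) (λ i → h (Fin.suc i))
  ∑-allFin-suc h = cong (λ s → h Fin.zero + s)
    (cong sumℤ (trans (map-tabulate Fin.suc h) (sym (map-tabulate (λ i → i) (λ i → h (Fin.suc i))))))

  ∑-filter : ∀ (L : List A) (p : A → Bool) (f : A → ℤ) →
    ∑ (filterᵇ p L) f ≡ ∑ L (λ e → ind (p e) (f e))
  ∑-filter []      p f = refl
  ∑-filter (x ∷ L) p f with p x
  ... | true  = cong (λ s → f x + s) (∑-filter L p f)
  ... | false = trans (∑-filter L p f) (sym (+-identityˡ _))

  head-fresh : ∀ {x : A} {L : List A} → Unique (x ∷ L) → ∀ {e} → e ∈ L → e ≢ x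
  head-fresh (x∉L ∷ _) p refl = All.lookup x∉L p refl

  ∑-point : ∀ (L : List A) {f : A → ℤ} {a : A} → Unique L → a ∈ L →
    (∀ {e} → e ∈ L → e ≢ a → f e ≡ 0ℤ) → ∑ L f ≡ f a
  ∑-point (x ∷ L) {f} u (here refl) h =
    trans (cong (λ s → f x + s) (∑-zero L (λ p → h (there p) (head-fresh u p)))) (+-identityʳ _)
  ∑-point (x ∷ L) {f} u@(_ ∷ u′) (there q) h =
    trans (cong₂ _+_ (h (here refl) (λ x≡a → head-fresh u q (sym x≡a))) (∑-point L u′ q (λ p → h (there p))))
          (+-identityˡ _)

  ∑-pair : ∀ (L : List A) {f : A → ℤ} {a b : A} → Unique L → a ∈ L → b ∈ L → a ≢ b →
    (∀ {e} → e ∈ L → e ≢ a → e ≢ b → f e ≡ 0ℤ) → ∑ L f ≡ f a + f b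
  ∑-pair (x ∷ L) u (here refl) (here refl) a≢b h = ⊥-elim (a≢b refl)
  ∑-pair (x ∷ L) {f} u@(_ ∷ u′) (here refl) (there q) a≢b h =
    cong (λ s → f x + s) (∑-point L u′ q (λ p → h (there p) (head-fresh u p)))
  ∑-pair (x ∷ L) {f} {a} u@(_ ∷ u′) (there p) (here refl) a≢b h =
    trans (cong (λ s → f x + s) (∑-point L u′ p (λ q e≢a → h (there q) e≢a (head-fresh u q))))
          (+-comm (f x) (f a))
  ∑-pair (x ∷ L) u@(_ ∷ u′) (there p) (there q) a≢b h =
    trans (cong₂ _+_ (h (here refl) (λ x≡a → head-fresh u p (sym x≡a)) (λ x≡b → head-fresh u q (sym x≡b)))
                     (∑-pair L u′ p q a≢b (λ r → h (there r))))
          (+-identityˡ _)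

  ∑-reindex : ∀ (_≟_ : DecidableEquality A) (E : List A) (F : List B) → Unique E → Unique F →
    {P : A → Bool} {p : B → Bool} {g : B → A} (f : A → ℤ) →
    (∀ {d} → d ∈ F → T (p d) → g d ∈ E) →
    (∀ {d} → d ∈ F → T (p d) → P (g d) ≡ true) →
    (∀ {e} → e ∈ E → P e ≡ true → Σ B λ d → d ∈ F × T (p d) × e ≡ g d) →
    (∀ {d d′} → T (p d) → T (p d′) → g d ≡ g d′ → d ≡ d′) →
    ∑ E (λ e → ind (P e) (f e)) ≡ ∑ F (λ d → ind (p d) (f (g d)))
  ∑-reindex {A} {B} _≟_ E F E-unique F-unique {P} {p} {g} f g∈E P-on-image image-of-P g-injective = begin
      ∑ E (λ e → ind (P e) (f e))
    ≡⟨ ∑-cong E as-fibre-sum ⟩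
      ∑ E (λ e → ∑ F (λ d → ind (p d) (hit e d)))
    ≡⟨ ∑-swap E F _ ⟩
      ∑ F (λ d → ∑ E (λ e → ind (p d) (hit e d)))
    ≡⟨ ∑-cong F (λ {d} d∈F → trans (∑-ind E (p d) (λ e → hit e d)) (only-g-d d∈F)) ⟩
      ∑ F (λ d → ind (p d) (f (g d))) ∎
    where
    open ≡-Reasoning
    hit : A → B → ℤ
    hit e d = ind ⌊ e ≟ g d ⌋ (f e)

    hit-self : ∀ d → hit (g d) d ≡ f (g d)
    hit-self d with g d ≟ g d
    ... | yes _  = refl
    ... | no ¬eq = ⊥-elim (¬eq refl)

    only-g-d : ∀ {d} → d ∈ F → ind (p d) (∑ E (λ e → hit e d)) ≡ ind (p d) (f (g d))
    only-g-d {d} d∈F with p d in pd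
    ... | false = refl
    ... | true  = trans (∑-point E E-unique (g∈E d∈F (≡⇒T pd)) miss) (hit-self d)
      where
      miss : ∀ {e} → e ∈ E → e ≢ g d → hit e d ≡ 0ℤ
      miss {e} _ e≢gd with e ≟ g d
      ... | yes e≡gd = ⊥-elim (e≢gd e≡gd)
      ... | no _     = refl

    -- Each e is hit by at most one d, and by one exactly when P e holds.
    as-fibre-sum : ∀ {e} → e ∈ E → ind (P e) (f e) ≡ ∑ F (λ d → ind (p d) (hit e d))
    as-fibre-sum {e} e∈E with P e in Pe
    ... | false = sym (∑-zero F no-hit)
      where
      no-hit : ∀ {d} → d ∈ F → ind (p d) (hit e d) ≡ 0ℤ
      no-hit {d} d∈F with p d in pd | e ≟ g d
      ... | false | _        = refl
      ... | true  | no _     = refl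
      ... | true  | yes refl = ⊥-elim (true≢false (trans (sym (P-on-image d∈F (≡⇒T pd))) Pe))
    ... | true with image-of-P e∈E Pe
    ...   | d , d∈F , pd , refl =
      sym (trans (∑-point F F-unique d∈F other) (trans (cong (λ b → ind b (hit (g d) d)) (T⇒≡ pd)) (hit-self d)))
      where
      other : ∀ {d′} → d′ ∈ F → d′ ≢ d → ind (p d′) (hit (g d) d′) ≡ 0ℤ
      other {d′} _ d′≢d with p d′ in pd′ | g d ≟ g d′
      ... | false | _       = refl
      ... | true  | no _    = refl
      ... | true  | yes eq  = ⊥-elim (d′≢d (sym (g-injective pd (≡⇒T pd′) eq)))

open Sums

module Counting where
  open import Data.Bool using (if_then_else_)
  open import Data.Unit using (tt)
  open import Data.Nat using (_≤_; _<_; z≤n; s≤s)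
  open import Data.Nat.Properties using (m≤n⇒m≤1+n)
  open import Data.Integer.Properties using (+-identityˡ; *-identityˡ; *-distribʳ-+)
  open import Data.Fin using (Fin; zero; suc)
  open import Data.List using ([]; _∷_; tabulate)
  open import Data.List.Relation.Unary.Any using (here; there)
  open import Data.List.Relation.Unary.AllPairs using (_∷_)
  open import Data.Product using (Σ)
  open import Data.Empty using (⊥-elim)
  open import Relation.Nullary using (¬_)
  open import Function using (_∘_)

  private variable
    A : Set

  count : (A → Bool) → List A → ℕ
  count p []      = 0
  count p (x ∷ L) = if p x then suc (count p L) else count p L

  count-mono : ∀ (L : List A) {p q : A → Bool} → (∀ {e} → e ∈ L → T (q e) → T (p e)) →
    count q L ≤ count p L
  count-mono []      h = z≤n
  count-mono (x ∷ L) {p} {q} h with q x in qx | p x in px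
  ... | true  | true  = s≤s (count-mono L (λ m → h (there m)))
  ... | true  | false = ⊥-elim (subst T px (h (here refl) (≡⇒T qx)))
  ... | false | true  = m≤n⇒m≤1+n (count-mono L (λ m → h (there m)))
  ... | false | false = count-mono L (λ m → h (there m))

  count-< : ∀ (L : List A) {p q : A → Bool} {a} → (∀ {e} → e ∈ L → T (q e) → T (p e)) →
    a ∈ L → T (p a) → ¬ T (q a) → count q L < count p L
  count-< (x ∷ L) {p} {q} h (here refl) pa ¬qa with q x in qx | p x in px
  ... | true  | _     = ⊥-elim (¬qa tt)
  ... | false | true  = s≤s (count-mono L (λ m → h (there m)))
  ... | false | false = ⊥-elim pa
  count-< (x ∷ L) {p} {q} h (there a∈) pa ¬qa with q x in qx | p x in px
  ... | true  | true  = s≤s (count-< L (λ m → h (there m)) a∈ pa ¬qa)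
  ... | true  | false = ⊥-elim (subst T px (h (here refl) (≡⇒T qx)))
  ... | false | true  = m≤n⇒m≤1+n (count-< L (λ m → h (there m)) a∈ pa ¬qa)
  ... | false | false = count-< L (λ m → h (there m)) a∈ pa ¬qa

  count-zero : ∀ (L : List A) {p : A → Bool} → count p L ≡ 0 → ∀ {e} → e ∈ L → p e ≡ false
  count-zero (x ∷ L) {p} eq e∈ with p x in px | e∈
  ... | false | here refl = px
  ... | false | there e∈L = count-zero L eq e∈L

  count-witness : ∀ (L : List A) {p : A → Bool} {c} → count p L ≡ suc c → Σ A λ e → p e ≡ true
  count-witness (x ∷ L) {p} eq with p x in px
  ... | true  = x , px
  ... | false = count-witness L eq

  count-cong : ∀ (L : List A) {p q : A → Bool} → (∀ {e} → e ∈ L → q e ≡ p e) → count q L ≡ count p L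
  count-cong []      h = refl
  count-cong (x ∷ L) h rewrite h (here refl) | count-cong L (λ e∈ → h (there e∈)) = refl

  count-drop : ∀ (L : List A) {p q : A → Bool} {r} → Unique L → r ∈ L → p r ≡ true → q r ≡ false →
    (∀ {e} → e ∈ L → e ≢ r → q e ≡ p e) → count p L ≡ suc (count q L)
  count-drop (x ∷ L) u (here refl) pr qr h
    rewrite pr | qr | count-cong L (λ e∈ → h (there e∈) (head-fresh u e∈)) = refl
  count-drop (x ∷ L) {p} u@(_ ∷ u′) (there r∈) pr qr h
    rewrite h (here refl) (λ x≡r → head-fresh u r∈ (sym x≡r)) | count-drop L u′ r∈ pr qr (λ e∈ → h (there e∈))
    with p x
  ... | true  = refl
  ... | false = refl

  ∑-count : ∀ (L : List A) (p : A → Bool) (c : ℤ) → ∑ L (λ e → ind (p e) c) ≡ + count p L * c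
  ∑-count []      p c = refl
  ∑-count (x ∷ L) p c with p x
  ... | true  = trans (cong (λ s → c + s) (∑-count L p c)) (one-more (count p L))
    where
    one-more : ∀ k → c + + k * c ≡ + suc k * c
    one-more k = trans (cong (λ s → s + + k * c) (sym (*-identityˡ c))) (sym (*-distribʳ-+ c (+ 1) (+ k)))
  ... | false = trans (+-identityˡ _) (∑-count L p c)

  count-tabulate : ∀ {k} (p : A → Bool) (g : Fin k → A) → (∀ i → p (g i) ≡ true) → count p (tabulate g) ≡ k
  count-tabulate {k = zero}  p g h = refl
  count-tabulate {k = suc k} p g h rewrite h zero = cong suc (count-tabulate p (g ∘ suc) (h ∘ suc))

open Counting

module Möbius {A : Set} (_≟_ : DecidableEquality A) (E : List A) (E-unique : Unique E)
  (_⊑_ : A → A → Bool)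
  (⊑-refl : ∀ {x} → x ∈ E → T (x ⊑ x))
  (⊑-trans : ∀ {x y z} → x ∈ E → y ∈ E → z ∈ E → T (x ⊑ y) → T (y ⊑ z) → T (x ⊑ z))
  (⊑-antisym : ∀ {x y} → x ∈ E → y ∈ E → T (x ⊑ y) → T (y ⊑ x) → x ≡ y)
  (μ : A → A → ℤ)
  (μ-diag : ∀ {x} → x ∈ E → μ x x ≡ 1ℤ)
  (μ-leftSum : ∀ {x y} → x ∈ E → y ∈ E → T (x ⊑ y) → x ≢ y →
     ∑ E (λ z → ind (x ⊑ z ∧ z ⊑ y) (μ x z)) ≡ 0ℤ)
  where
  open import Data.Nat using (_<_; s≤s)
  open import Data.Nat.Properties using (<-≤-trans; n<1+n)
  open import Data.Integer.Properties using (+-0-abelianGroup; *-zeroʳ; *-zeroˡ; *-identityˡ; *-identityʳ; *-comm)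
  open import Algebra.Bundles using (AbelianGroup)
  open import Algebra.Properties.Group (AbelianGroup.group +-0-abelianGroup)
    using (identityˡ-unique; inverseʳ-unique)
  open import Data.Sum using (_⊎_; inj₁; inj₂)
  open import Data.Empty using (⊥-elim)
  open import Relation.Nullary using (yes; no; ⌊_⌋)

  ∑-interval-diag : ∀ {x} → x ∈ E → (f : A → ℤ) → ∑ E (λ z → ind (x ⊑ z ∧ z ⊑ x) (f z)) ≡ f x
  ∑-interval-diag {x} x∈ f =
    trans (∑-point E E-unique x∈ outside) (cong (λ b → ind (b ∧ b) (f x)) (T⇒≡ (⊑-refl x∈)))
    where
    outside : ∀ {e} → e ∈ E → e ≢ x → ind (x ⊑ e ∧ e ⊑ x) (f e) ≡ 0ℤ
    outside {e} e∈ e≢x with x ⊑ e in p | e ⊑ x in q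
    ... | true  | true  = ⊥-elim (e≢x (⊑-antisym e∈ x∈ (≡⇒T q) (≡⇒T p)))
    ... | true  | false = refl
    ... | false | _     = refl

  rightSum : A → A → ℤ
  rightSum w y = ∑ E (λ z → ind (w ⊑ z ∧ z ⊑ y) (μ z y))

  -- Both sides are μ(x,w)μ(z,y) guarded by the chain x ⊑ w ⊑ z ⊑ y.
  chain-swap : ∀ {x y w z} → x ∈ E → y ∈ E → w ∈ E → z ∈ E →
    ind (x ⊑ w ∧ w ⊑ y) (μ x w) * ind (w ⊑ z ∧ z ⊑ y) (μ z y)
    ≡ ind (x ⊑ z ∧ z ⊑ y) (μ z y) * ind (x ⊑ w ∧ w ⊑ z) (μ x w)
  chain-swap {x} {y} {w} {z} x∈ y∈ w∈ z∈
    with x ⊑ w in xw | w ⊑ z in wz | z ⊑ y in zy | x ⊑ z in xz | w ⊑ y in wy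
  ... | true | true | true | true | true = *-comm (μ x w) (μ z y)
  ... | true | true | true | false | _ =
    ⊥-elim (subst T xz (⊑-trans x∈ w∈ z∈ (≡⇒T xw) (≡⇒T wz)))
  ... | true | true | true | true | false =
    ⊥-elim (subst T wy (⊑-trans w∈ z∈ y∈ (≡⇒T wz) (≡⇒T zy)))
  ... | false | _ | b3 | b4 | _ = sym (*-zeroʳ (ind (b4 ∧ b3) (μ z y)))
  ... | true | false | b3 | b4 | b5 = trans (*-zeroʳ (ind b5 (μ x w))) (sym (*-zeroʳ (ind (b4 ∧ b3) (μ z y))))
  ... | true | true | false | true | b5 = *-zeroʳ (ind b5 (μ x w))
  ... | true | true | false | false | b5 = *-zeroʳ (ind b5 (μ x w))

  -- Associativity in the incidence algebra: convolving μ with the right sums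
  -- gives back μ, because the left sums of μ are the Kronecker delta.
  μ⋆rightSum : ∀ {x y} → x ∈ E → y ∈ E → T (x ⊑ y) →
    ∑ E (λ w → ind (x ⊑ w ∧ w ⊑ y) (μ x w) * rightSum w y) ≡ μ x y
  μ⋆rightSum {x} {y} x∈ y∈ x⊑y = begin
      ∑ E (λ w → ind (x ⊑ w ∧ w ⊑ y) (μ x w) * rightSum w y)
    ≡⟨ ∑-cong E (λ {w} _ → sym (∑-scale E (ind (x ⊑ w ∧ w ⊑ y) (μ x w)) _)) ⟩
      ∑ E (λ w → ∑ E (λ z → ind (x ⊑ w ∧ w ⊑ y) (μ x w) * ind (w ⊑ z ∧ z ⊑ y) (μ z y)))
    ≡⟨ ∑-swap E E _ ⟩
      ∑ E (λ z → ∑ E (λ w → ind (x ⊑ w ∧ w ⊑ y) (μ x w) * ind (w ⊑ z ∧ z ⊑ y) (μ z y)))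
    ≡⟨ ∑-cong E (λ z∈ → ∑-cong E (λ w∈ → chain-swap x∈ y∈ w∈ z∈)) ⟩
      ∑ E (λ z → ∑ E (λ w → ind (x ⊑ z ∧ z ⊑ y) (μ z y) * ind (x ⊑ w ∧ w ⊑ z) (μ x w)))
    ≡⟨ ∑-cong E (λ {z} _ → ∑-scale E (ind (x ⊑ z ∧ z ⊑ y) (μ z y)) _) ⟩
      ∑ E (λ z → ind (x ⊑ z ∧ z ⊑ y) (μ z y) * ∑ E (λ w → ind (x ⊑ w ∧ w ⊑ z) (μ x w)))
    ≡⟨ ∑-point E E-unique x∈ above-x ⟩
      ind (x ⊑ x ∧ x ⊑ y) (μ x y) * ∑ E (λ w → ind (x ⊑ w ∧ w ⊑ x) (μ x w))
    ≡⟨ cong₂ (λ b s → ind (b ∧ x ⊑ y) (μ x y) * s) (T⇒≡ (⊑-refl x∈)) (∑-interval-diag x∈ (μ x)) ⟩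
      ind (x ⊑ y) (μ x y) * μ x x
    ≡⟨ cong₂ (λ b s → ind b (μ x y) * s) (T⇒≡ x⊑y) (μ-diag x∈) ⟩
      μ x y * 1ℤ
    ≡⟨ *-identityʳ _ ⟩
      μ x y ∎
    where
    open ≡-Reasoning
    above-x : ∀ {z} → z ∈ E → z ≢ x →
      ind (x ⊑ z ∧ z ⊑ y) (μ z y) * ∑ E (λ w → ind (x ⊑ w ∧ w ⊑ z) (μ x w)) ≡ 0ℤ
    above-x {z} z∈ z≢x with x ⊑ z in xz
    ... | false = refl
    ... | true  = trans (cong (ind (z ⊑ y) (μ z y) *_) (μ-leftSum x∈ z∈ (≡⇒T xz) (λ x≡z → z≢x (sym x≡z))))
                        (*-zeroʳ (ind (z ⊑ y) (μ z y)))

  -- The number of elements above w; it strictly decreases along the order,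
  -- and is the measure for the induction below.
  countAbove : A → ℕ
  countAbove w = count (w ⊑_) E

  countAbove-< : ∀ {w w′} → w ∈ E → w′ ∈ E → T (w ⊑ w′) → w′ ≢ w → countAbove w′ < countAbove w
  countAbove-< w∈ w′∈ w⊑w′ w′≢w =
    count-< E (λ e∈ w′⊑e → ⊑-trans w∈ w′∈ e∈ w⊑w′ w′⊑e) w∈ (⊑-refl w∈)
            (λ w′⊑w → w′≢w (⊑-antisym w′∈ w∈ w′⊑w w⊑w′))

  -- In μ⋆rightSum at (w,y) only the terms w′ = w and w′ = y survive (by induction
  -- on countAbove), which leaves rightSum w y + μ(w,y) = μ(w,y).
  rightSum-vanishes : ∀ {w y} → w ∈ E → y ∈ E → T (w ⊑ y) → w ≢ y → rightSum w y ≡ 0ℤ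
  rightSum-vanishes w∈ y∈ = go (suc (countAbove _)) (n<1+n _) w∈ y∈
    where
    go : ∀ k {w y} → countAbove w < k → w ∈ E → y ∈ E → T (w ⊑ y) → w ≢ y → rightSum w y ≡ 0ℤ
    go (suc k) {w} {y} (s≤s bound) w∈ y∈ w⊑y w≢y =
      identityˡ-unique (rightSum w y) (μ w y) (trans (sym two-terms) (μ⋆rightSum w∈ y∈ w⊑y))
      where
      term : A → ℤ
      term w′ = ind (w ⊑ w′ ∧ w′ ⊑ y) (μ w w′) * rightSum w′ y
      term-w : term w ≡ rightSum w y
      term-w rewrite T⇒≡ (⊑-refl w∈) | T⇒≡ w⊑y | μ-diag w∈ = *-identityˡ _
      term-y : term y ≡ μ w y
      term-y rewrite T⇒≡ (⊑-refl y∈) | T⇒≡ w⊑y | ∑-interval-diag y∈ (λ z → μ z y) | μ-diag y∈ = *-identityʳ _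
      strictly-between : ∀ {w′} → w′ ∈ E → w′ ≢ w → w′ ≢ y → term w′ ≡ 0ℤ
      strictly-between {w′} w′∈ w′≢w w′≢y with w ⊑ w′ in ww′ | w′ ⊑ y in w′y
      ... | false | _     = refl
      ... | true  | false = refl
      ... | true  | true  =
        trans (cong (μ w w′ *_) (go k (<-≤-trans (countAbove-< w∈ w′∈ (≡⇒T ww′) w′≢w) bound)
                                   w′∈ y∈ (≡⇒T w′y) w′≢y))
              (*-zeroʳ (μ w w′))
      two-terms : ∑ E term ≡ rightSum w y + μ w y
      two-terms = trans (∑-pair E E-unique w∈ y∈ w≢y strictly-between) (cong₂ _+_ term-w term-y)

  μ-cover : ∀ {x y} → x ∈ E → y ∈ E → T (x ⊑ y) → x ≢ y →
    (∀ {z} → z ∈ E → T (x ⊑ z) → T (z ⊑ y) → z ≡ x ⊎ z ≡ y) → μ x y ≡ -1ℤ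
  μ-cover {x} {y} x∈ y∈ x⊑y x≢y cover =
    inverseʳ-unique 1ℤ (μ x y) (trans (sym two-terms) (μ-leftSum x∈ y∈ x⊑y x≢y))
    where
    term : A → ℤ
    term z = ind (x ⊑ z ∧ z ⊑ y) (μ x z)
    term-x : term x ≡ 1ℤ
    term-x rewrite T⇒≡ (⊑-refl x∈) | T⇒≡ x⊑y = μ-diag x∈
    term-y : term y ≡ μ x y
    term-y rewrite T⇒≡ (⊑-refl y∈) | T⇒≡ x⊑y = refl
    strictly-between : ∀ {z} → z ∈ E → z ≢ x → z ≢ y → term z ≡ 0ℤ
    strictly-between {z} z∈ z≢x z≢y with x ⊑ z in xz | z ⊑ y in zy
    ... | false | _     = refl
    ... | true  | false = refl
    ... | true  | true  with cover z∈ (≡⇒T xz) (≡⇒T zy)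
    ...   | inj₁ z≡x = ⊥-elim (z≢x z≡x)
    ...   | inj₂ z≡y = ⊥-elim (z≢y z≡y)
    two-terms : ∑ E term ≡ 1ℤ + μ x y
    two-terms = trans (∑-pair E E-unique x∈ y∈ x≢y strictly-between) (cong₂ _+_ term-x term-y)

  -- Weisner's theorem. Let t be the top element, x ⊑ a ≠ t, and let m be the
  -- meet with a (z ⊑ m y iff z ⊑ y and z ⊑ a). Then Σ_{x ⊑ y, m y = x} μ(y,t) = 0.
  -- Expand the guard m y = x as the left sum Σ_{x ⊑ z ⊑ m y} μ(x,z), swap the
  -- two sums, and observe that each inner right sum over [z,t] with z ⊑ a vanishes.
  module Weisner (t : A) (t∈ : t ∈ E) (⊑-top : ∀ {z} → z ∈ E → T (z ⊑ t))
    {x a : A} (x∈ : x ∈ E) (a∈ : a ∈ E) (x⊑a : T (x ⊑ a)) (a≢t : a ≢ t)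
    (m : A → A) (m∈ : ∀ {y} → y ∈ E → m y ∈ E)
    (⊑-m : ∀ {z y} → z ∈ E → y ∈ E → z ⊑ m y ≡ (z ⊑ y ∧ z ⊑ a)) where

    guard-as-leftSum : ∀ {y} → y ∈ E →
      ind (x ⊑ y ∧ ⌊ m y ≟ x ⌋) (μ y t) ≡ ind (x ⊑ y) (μ y t) * ∑ E (λ z → ind (x ⊑ z ∧ z ⊑ m y) (μ x z))
    guard-as-leftSum {y} y∈ with x ⊑ y in xy
    ... | false = refl
    ... | true with m y ≟ x
    ...   | yes refl = sym (trans (cong (μ y t *_) (∑-interval-diag x∈ (μ x)))
                                  (trans (cong (μ y t *_) (μ-diag x∈)) (*-identityʳ _)))
    ...   | no my≢x = sym (trans (cong (μ y t *_) (μ-leftSum x∈ (m∈ y∈) x⊑my (λ x≡my → my≢x (sym x≡my))))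
                                 (*-zeroʳ (μ y t)))
      where
      x⊑my : T (x ⊑ m y)
      x⊑my = subst T (sym (⊑-m x∈ y∈)) (∧-intro (≡⇒T xy) x⊑a)

    -- Both sides are μ(x,z)μ(y,t) guarded by x ⊑ z, z ⊑ a and z ⊑ y.
    meet-swap : ∀ {y z} → y ∈ E → z ∈ E →
      ind (x ⊑ y) (μ y t) * ind (x ⊑ z ∧ z ⊑ m y) (μ x z)
      ≡ ind (x ⊑ z ∧ z ⊑ a) (μ x z) * ind (z ⊑ y ∧ y ⊑ t) (μ y t)
    meet-swap {y} {z} y∈ z∈ rewrite ⊑-m z∈ y∈ | T⇒≡ (⊑-top y∈)
      with x ⊑ y in xy | x ⊑ z in xz | z ⊑ y in zy | z ⊑ a
    ... | true  | true  | true  | true  = *-comm (μ y t) (μ x z)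
    ... | true  | true  | true  | false = trans (*-zeroʳ (μ y t)) (sym (*-zeroˡ (μ y t)))
    ... | true  | true  | false | b     = trans (*-zeroʳ (μ y t)) (sym (*-zeroʳ (ind b (μ x z))))
    ... | true  | false | b     | _     = trans (*-zeroʳ (μ y t)) (sym (*-zeroˡ (ind (b ∧ true) (μ y t))))
    ... | false | true  | true  | _     = ⊥-elim (subst T xy (⊑-trans x∈ z∈ y∈ (≡⇒T xz) (≡⇒T zy)))
    ... | false | true  | false | b     = sym (*-zeroʳ (ind b (μ x z)))
    ... | false | false | _     | _     = refl

    weisner : ∑ E (λ y → ind (x ⊑ y ∧ ⌊ m y ≟ x ⌋) (μ y t)) ≡ 0ℤ
    weisner = begin
        ∑ E (λ y → ind (x ⊑ y ∧ ⌊ m y ≟ x ⌋) (μ y t))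
      ≡⟨ ∑-cong E guard-as-leftSum ⟩
        ∑ E (λ y → ind (x ⊑ y) (μ y t) * ∑ E (λ z → ind (x ⊑ z ∧ z ⊑ m y) (μ x z)))
      ≡⟨ ∑-cong E (λ {y} _ → sym (∑-scale E (ind (x ⊑ y) (μ y t)) _)) ⟩
        ∑ E (λ y → ∑ E (λ z → ind (x ⊑ y) (μ y t) * ind (x ⊑ z ∧ z ⊑ m y) (μ x z)))
      ≡⟨ ∑-swap E E _ ⟩
        ∑ E (λ z → ∑ E (λ y → ind (x ⊑ y) (μ y t) * ind (x ⊑ z ∧ z ⊑ m y) (μ x z)))
      ≡⟨ ∑-cong E (λ z∈ → ∑-cong E (λ y∈ → meet-swap y∈ z∈)) ⟩
        ∑ E (λ z → ∑ E (λ y → ind (x ⊑ z ∧ z ⊑ a) (μ x z) * ind (z ⊑ y ∧ y ⊑ t) (μ y t)))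
      ≡⟨ ∑-cong E (λ {z} _ → ∑-scale E (ind (x ⊑ z ∧ z ⊑ a) (μ x z)) _) ⟩
        ∑ E (λ z → ind (x ⊑ z ∧ z ⊑ a) (μ x z) * rightSum z t)
      ≡⟨ ∑-zero E below-a ⟩
        0ℤ ∎
      where
      open ≡-Reasoning
      below-a : ∀ {z} → z ∈ E → ind (x ⊑ z ∧ z ⊑ a) (μ x z) * rightSum z t ≡ 0ℤ
      below-a {z} z∈ with x ⊑ z | z ⊑ a in za
      ... | false | _     = refl
      ... | true  | false = refl
      ... | true  | true  =
        trans (cong (μ x z *_) (rightSum-vanishes z∈ t∈ (⊑-top z∈)
                                 (λ { refl → a≢t (⊑-antisym a∈ t∈ (⊑-top a∈) (≡⇒T za)) })))
              (*-zeroʳ (μ x z))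

module Encoding where
  open import Data.Bool.Properties using () renaming (_≟_ to _≟ᵇ_)
  open import Data.Unit using (tt)
  open import Data.Fin using (Fin)
  open import Data.Vec using (Vec; lookup; tabulate)
  open import Data.Vec.Properties using (tabulate∘lookup; lookup∘tabulate; tabulate-cong)
  import Data.Vec.Properties as Vec
  import Data.Product.Properties as Product
  open import Data.List using ([]; _∷_; foldr; allFin)
  open import Data.List.Membership.Propositional.Properties using (∈-allFin)
  open import Data.List.Relation.Unary.Any using (here; there)
  open import Function using (_∘_)

  ⇒ᵇ-intro : ∀ {a b} → (T a → T b) → T (a ⇒ᵇ b)
  ⇒ᵇ-intro {true}  {true}  f = tt
  ⇒ᵇ-intro {true}  {false} f = f tt
  ⇒ᵇ-intro {false}         f = tt

  ⇒ᵇ-elim : ∀ {a b} → T (a ⇒ᵇ b) → T a → T b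
  ⇒ᵇ-elim {true} {true} _ _ = tt

  ⇔ᵇ-intro : ∀ {a b} → a ≡ b → T (a ⇔ᵇ b)
  ⇔ᵇ-intro {true}  refl = tt
  ⇔ᵇ-intro {false} refl = tt

  ⇔ᵇ-elim : ∀ {a b} → T (a ⇔ᵇ b) → a ≡ b
  ⇔ᵇ-elim {true}  {true}  _ = refl
  ⇔ᵇ-elim {false} {false} _ = refl

  ∀ᶠ-intro : ∀ {n} {p : Fin n → Bool} → (∀ i → T (p i)) → T (∀ᶠ p)
  ∀ᶠ-intro {n} {p} h = go (allFin n)
    where
    go : ∀ L → T (foldr (λ i b → p i ∧ b) true L)
    go []      = tt
    go (i ∷ L) = ∧-intro (h i) (go L)

  ∀ᶠ-elim : ∀ {n} {p : Fin n → Bool} → T (∀ᶠ p) → ∀ i → T (p i)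
  ∀ᶠ-elim {n} {p} h i = go (allFin n) h (∈-allFin i)
    where
    go : ∀ L → T (foldr (λ i b → p i ∧ b) true L) → ∀ {i} → i ∈ L → T (p i)
    go (j ∷ L) h (here refl) = ∧-fst h
    go (j ∷ L) h (there i∈) = go L (∧-snd {p j} h) i∈

  ∀ᶠ²-intro : ∀ {n} {p : Fin n → Fin n → Bool} → (∀ i j → T (p i j)) → T (∀ᶠ λ i → ∀ᶠ λ j → p i j)
  ∀ᶠ²-intro h = ∀ᶠ-intro λ i → ∀ᶠ-intro (h i)

  ∀ᶠ²-elim : ∀ {n} {p : Fin n → Fin n → Bool} → T (∀ᶠ λ i → ∀ᶠ λ j → p i j) → ∀ i j → T (p i j)
  ∀ᶠ²-elim h i = ∀ᶠ-elim (∀ᶠ-elim h i)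

  ∀ᶠ³-intro : ∀ {n} {p : Fin n → Fin n → Fin n → Bool} → (∀ i j k → T (p i j k)) →
    T (∀ᶠ λ i → ∀ᶠ λ j → ∀ᶠ λ k → p i j k)
  ∀ᶠ³-intro h = ∀ᶠ-intro λ i → ∀ᶠ²-intro (h i)

  ∀ᶠ³-elim : ∀ {n} {p : Fin n → Fin n → Fin n → Bool} → T (∀ᶠ λ i → ∀ᶠ λ j → ∀ᶠ λ k → p i j k) →
    ∀ i j k → T (p i j k)
  ∀ᶠ³-elim h i = ∀ᶠ²-elim (∀ᶠ-elim h i)

  module _ {n : ℕ} where

    -- R r i j: i and j lie in the same block of r. It is a record rather than
    -- T (rel r i j) so that r, i and j can be inferred from it.
    record R (r : Raw n) (i j : Fin n) : Set where
      constructor inR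
      field outR : T (rel r i j)
    open R public

    record Valid (r : Raw n) : Set where
      field
        rf : ∀ i → R r i i
        sy : ∀ {i j} → R r i j → R r j i
        tr : ∀ {i j k} → R r i j → R r j k → R r i k
        lb : ∀ {i j} → R r i j → lab r i ≡ lab r j

    valid-intro : ∀ {r} → Valid r → T (valid r)
    valid-intro {r} v =
      ∧-intro {∀ᶠ (λ i → rel r i i)} (∀ᶠ-intro (outR ∘ rf))
        (∧-intro {∀ᶠ (λ i → ∀ᶠ (λ j → rel r i j ⇔ᵇ rel r j i))}
          (∀ᶠ²-intro λ i j → ⇔ᵇ-intro (T-ext (outR ∘ sy {i} {j} ∘ inR) (outR ∘ sy {j} {i} ∘ inR)))
          (∧-intro {∀ᶠ (λ i → ∀ᶠ (λ j → ∀ᶠ (λ k → (rel r i j ∧ rel r j k) ⇒ᵇ rel r i k)))}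
            (∀ᶠ³-intro λ i j k → ⇒ᵇ-intro {rel r i j ∧ rel r j k} λ p →
               outR (tr (inR (∧-fst p)) (inR (∧-snd {rel r i j} p))))
            (∀ᶠ²-intro λ i j → ⇒ᵇ-intro {rel r i j} λ p → ⇔ᵇ-intro (lb (inR p)))))
      where open Valid v

    valid-elim : ∀ {r} → T (valid r) → Valid r
    valid-elim {r} h = record
      { rf = λ i → inR (∀ᶠ-elim (∧-fst h) i)
      ; sy = λ {i} {j} p → inR (subst T (⇔ᵇ-elim (∀ᶠ²-elim (∧-fst symm) i j)) (outR p))
      ; tr = λ {i} {j} {k} p q → inR (⇒ᵇ-elim (∀ᶠ³-elim (∧-fst trans′) i j k) (∧-intro (outR p) (outR q)))
      ; lb = λ {i} {j} p → ⇔ᵇ-elim (⇒ᵇ-elim (∀ᶠ²-elim labels i j) (outR p)) }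
      where
      symm   = ∧-snd {∀ᶠ (λ i → rel r i i)} h
      trans′ = ∧-snd {∀ᶠ (λ i → ∀ᶠ (λ j → rel r i j ⇔ᵇ rel r j i))} symm
      labels = ∧-snd {∀ᶠ (λ i → ∀ᶠ (λ j → ∀ᶠ (λ k → (rel r i j ∧ rel r j k) ⇒ᵇ rel r i k)))} trans′

    record Le (σ π : Raw n) : Set where
      field
        lr : ∀ {i j} → R σ i j → R π i j
        ll : ∀ {i} → T (lab σ i) → T (lab π i)

    le-intro : ∀ {σ π} → Le σ π → σ ≤ₗ π
    le-intro {σ} {π} l =
      ∧-intro {∀ᶠ (λ i → ∀ᶠ (λ j → rel σ i j ⇒ᵇ rel π i j))}
        (∀ᶠ²-intro λ i j → ⇒ᵇ-intro {rel σ i j} (outR ∘ lr ∘ inR))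
        (∀ᶠ-intro λ i → ⇒ᵇ-intro {lab σ i} ll)
      where open Le l

    le-elim : ∀ {σ π} → σ ≤ₗ π → Le σ π
    le-elim {σ} {π} h = record
      { lr = λ {i} {j} p → inR (⇒ᵇ-elim (∀ᶠ²-elim (∧-fst h) i j) (outR p))
      ; ll = λ {i} → ⇒ᵇ-elim (∀ᶠ-elim (∧-snd {∀ᶠ (λ i → ∀ᶠ (λ j → rel σ i j ⇒ᵇ rel π i j))} h) i) }

    raw-ext : ∀ (r s : Raw n) → (∀ i j → rel r i j ≡ rel s i j) → (∀ i → lab r i ≡ lab s i) → r ≡ s
    raw-ext (M , L) (M′ , L′) hr hl = cong₂ _,_ (vec-ext M M′ (λ i → vec-ext _ _ (hr i))) (vec-ext L L′ hl)
      where
      vec-ext : ∀ {A : Set} (xs ys : Vec A n) → (∀ i → lookup xs i ≡ lookup ys i) → xs ≡ ys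
      vec-ext xs ys h = trans (sym (tabulate∘lookup xs)) (trans (tabulate-cong h) (tabulate∘lookup ys))

    raw-ext′ : ∀ (r s : Raw n) → (∀ {i j} → R r i j → R s i j) → (∀ {i j} → R s i j → R r i j) →
      (∀ i → lab r i ≡ lab s i) → r ≡ s
    raw-ext′ r s rs sr hl = raw-ext r s (λ i j → T-ext (outR ∘ rs ∘ inR) (outR ∘ sr ∘ inR)) hl

    _≟R_ : DecidableEquality (Raw n)
    _≟R_ = Product.≡-dec (Vec.≡-dec (Vec.≡-dec _≟ᵇ_)) (Vec.≡-dec _≟ᵇ_)

    mk : (Fin n → Fin n → Bool) → (Fin n → Bool) → Raw n
    mk f g = tabulate (λ i → tabulate (f i)) , tabulate g

    rel-mk : ∀ f g i j → rel (mk f g) i j ≡ f i j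
    rel-mk f g i j = trans (cong (λ v → lookup v j) (lookup∘tabulate (λ i → tabulate (f i)) i))
                           (lookup∘tabulate (f i) j)

    lab-mk : ∀ f g i → lab (mk f g) i ≡ g i
    lab-mk f g i = lookup∘tabulate g i

    ≤ₗ-refl : ∀ {x} → x ≤ₗ x
    ≤ₗ-refl {x} = le-intro {x} {x} (record { lr = λ p → p ; ll = λ p → p })

    ≤ₗ-trans : ∀ {x y z} → x ≤ₗ y → y ≤ₗ z → x ≤ₗ z
    ≤ₗ-trans {x} {y} {z} p q = le-intro {x} {z} (record
      { lr = λ r → Le.lr (le-elim {y} {z} q) (Le.lr (le-elim {x} {y} p) r)
      ; ll = λ r → Le.ll (le-elim {y} {z} q) (Le.ll (le-elim {x} {y} p) r) })

    ≤ₗ-antisym : ∀ {x y} → x ≤ₗ y → y ≤ₗ x → x ≡ y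
    ≤ₗ-antisym {x} {y} p q =
      raw-ext x y (λ i j → T-ext (outR ∘ Le.lr P ∘ inR) (outR ∘ Le.lr Q ∘ inR)) (λ i → T-ext (Le.ll P) (Le.ll Q))
      where P = le-elim {x} {y} p ; Q = le-elim {y} {x} q

open Encoding

module Enumeration where
  open import Data.Vec using (Vec; []; _∷_)
  open import Data.Vec.Properties using (∷-injective)
  open import Data.List using ([]; _∷_; map)
  open import Data.List.Membership.Propositional.Properties
    using (∈-concatMap⁺; ∈-map⁺; ∈-map⁻; ∈-filter⁺; ∈-filter⁻; ∈-cartesianProduct⁺)
  open import Data.List.Relation.Unary.Any as Any using (here; there)
  open import Data.List.Relation.Unary.All as All using ()
  import Data.List.Relation.Unary.All.Properties as All
  import Data.List.Relation.Unary.AllPairs as AllPairs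
  import Data.List.Relation.Unary.AllPairs.Properties as AllPairs
  import Data.List.Relation.Unary.Unique.Propositional.Properties as Unique
  open import Data.Product using (proj₁; proj₂)
  open import Function using (_∘_)
  open import Relation.Nullary using (¬_)
  open import Relation.Nullary.Decidable using (T?)

  private
    bools : List Bool
    bools = true ∷ false ∷ []

    ∈-bools : ∀ b → b ∈ bools
    ∈-bools true  = here refl
    ∈-bools false = there (here refl)

    bools-unique : Unique bools
    bools-unique = ((λ ()) All.∷ All.[]) AllPairs.∷ (All.[] AllPairs.∷ AllPairs.[])

  ∈-allVec : ∀ {A : Set} (xs : List A) → (∀ a → a ∈ xs) → ∀ n (v : Vec A n) → v ∈ allVec xs n
  ∈-allVec xs h zero    []      = here refl
  ∈-allVec xs h (suc n) (a ∷ v) =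
    ∈-concatMap⁺ (λ x → map (x ∷_) (allVec xs n))
                 (Any.map (λ { refl → ∈-map⁺ (a ∷_) (∈-allVec xs h n v) }) (h a))

  allVec-unique : ∀ {A : Set} (xs : List A) → Unique xs → ∀ n → Unique (allVec xs n)
  allVec-unique xs u zero    = All.[] AllPairs.∷ AllPairs.[]
  allVec-unique xs u (suc n) =
    Unique.concat⁺ (All.map⁺ (All.tabulate (λ _ → Unique.map⁺ (proj₂ ∘ ∷-injective) (allVec-unique xs u n))))
                   (AllPairs.map⁺ (AllPairs.map disjoint u))
    where
    disjoint : ∀ {x y} → x ≢ y → ∀ {v} → ¬ (v ∈ map (x ∷_) (allVec xs n) × v ∈ map (y ∷_) (allVec xs n))
    disjoint x≢y (p , q) with ∈-map⁻ _ p | ∈-map⁻ _ q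
    ... | _ , _ , refl | _ , _ , eq = x≢y (proj₁ (∷-injective eq))

  ∈-elements : ∀ {n} (r : Raw n) → T (valid r) → r ∈ elements n
  ∈-elements {n} (M , L) v =
    ∈-filter⁺ (T? ∘ valid)
      (∈-cartesianProduct⁺ (∈-allVec _ (∈-allVec _ ∈-bools n) n M) (∈-allVec _ ∈-bools n L)) v

  elements-valid : ∀ {n} {r : Raw n} → r ∈ elements n → T (valid r)
  elements-valid {n} r∈ = proj₂ (∈-filter⁻ (T? ∘ valid) {xs = allRaw n} r∈)

  elements-unique : ∀ n → Unique (elements n)
  elements-unique n =
    Unique.filter⁺ (T? ∘ valid)
      (Unique.cartesianProduct⁺ (allVec-unique _ (allVec-unique _ bools-unique n) n) (allVec-unique _ bools-unique n))

open Enumeration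

module Constructions where
  open import Data.Unit using (tt)
  open import Data.Fin using (Fin)
  open import Data.Product using (proj₁; proj₂)
  open import Relation.Nullary.Decidable using (toWitness; fromWitness)

  module _ {n : ℕ} where

    fibres : (Fin n → Fin n) → Bool → Raw n
    fibres h b = mk (λ i j → h i ==ᶠ h j) (λ _ → b)

    fibres-R : ∀ h b {i j} → R (fibres h b) i j → h i ≡ h j
    fibres-R h b {i} {j} p = toWitness (subst T (rel-mk _ (λ _ → b) i j) (outR p))

    fibres-R⁻ : ∀ h b {i j} → h i ≡ h j → R (fibres h b) i j
    fibres-R⁻ h b {i} {j} q = inR (subst T (sym (rel-mk _ (λ _ → b) i j)) (fromWitness q))

    fibres-lab : ∀ h b i → lab (fibres h b) i ≡ b
    fibres-lab h b = lab-mk (λ i j → h i ==ᶠ h j) (λ _ → b)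

    fibres-valid : ∀ h b → T (valid (fibres h b))
    fibres-valid h b = valid-intro {r = fibres h b} (record
      { rf = λ i → fibres-R⁻ h b refl
      ; sy = λ p → fibres-R⁻ h b (sym (fibres-R h b p))
      ; tr = λ p q → fibres-R⁻ h b (trans (fibres-R h b p) (fibres-R h b q))
      ; lb = λ {i} {j} _ → trans (fibres-lab h b i) (sym (fibres-lab h b j)) })

    fibres-cong : ∀ {h h′} b → (∀ i → h i ≡ h′ i) → fibres h b ≡ fibres h′ b
    fibres-cong {h} {h′} b e = raw-ext _ _
      (λ i j → trans (rel-mk _ (λ _ → b) i j) (trans (cong₂ _==ᶠ_ (e i) (e j)) (sym (rel-mk _ (λ _ → b) i j))))
      (λ i → trans (fibres-lab h b i) (sym (fibres-lab h′ b i)))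

    split : (Fin n → Bool) → Raw n
    split S = mk (λ i j → S i ⇔ᵇ S j) (λ _ → true)

    split-R : ∀ S {i j} → R (split S) i j → S i ≡ S j
    split-R S {i} {j} p = ⇔ᵇ-elim (subst T (rel-mk (λ i j → S i ⇔ᵇ S j) (λ _ → true) i j) (outR p))

    split-R⁻ : ∀ S {i j} → S i ≡ S j → R (split S) i j
    split-R⁻ S {i} {j} q = inR (subst T (sym (rel-mk (λ i j → S i ⇔ᵇ S j) (λ _ → true) i j)) (⇔ᵇ-intro q))

    split-lab : ∀ S i → lab (split S) i ≡ true
    split-lab S = lab-mk (λ i j → S i ⇔ᵇ S j) (λ _ → true)

    split-valid : ∀ S → T (valid (split S))
    split-valid S = valid-intro {r = split S} (record
      { rf = λ i → split-R⁻ S refl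
      ; sy = λ p → split-R⁻ S (sym (split-R S p))
      ; tr = λ p q → split-R⁻ S (trans (split-R S p) (split-R S q))
      ; lb = λ {i} {j} _ → trans (split-lab S i) (sym (split-lab S j)) })

    _⊓_ : Raw n → Raw n → Raw n
    y ⊓ a = mk (λ i j → rel y i j ∧ rel a i j) (λ i → lab y i ∧ lab a i)

    ⊓-R : ∀ y a {i j} → R (y ⊓ a) i j → R y i j × R a i j
    ⊓-R y a {i} {j} p = inR (∧-fst both) , inR (∧-snd {rel y i j} both)
      where both = subst T (rel-mk (λ i j → rel y i j ∧ rel a i j) (λ i → lab y i ∧ lab a i) i j) (outR p)

    ⊓-R⁻ : ∀ {y a i j} → R y i j → R a i j → R (y ⊓ a) i j
    ⊓-R⁻ {y} {a} {i} {j} p q =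
      inR (subst T (sym (rel-mk (λ i j → rel y i j ∧ rel a i j) (λ i → lab y i ∧ lab a i) i j)) (∧-intro (outR p) (outR q)))

    ⊓-lab : ∀ y a i → lab (y ⊓ a) i ≡ (lab y i ∧ lab a i)
    ⊓-lab y a = lab-mk (λ i j → rel y i j ∧ rel a i j) (λ i → lab y i ∧ lab a i)

    ⊓-valid : ∀ y a → T (valid y) → T (valid a) → T (valid (y ⊓ a))
    ⊓-valid y a vy va = valid-intro {r = y ⊓ a} (record
      { rf = λ i → ⊓-R⁻ (Y.rf i) (A.rf i)
      ; sy = λ p → ⊓-R⁻ (Y.sy (inY p)) (A.sy (inA p))
      ; tr = λ p q → ⊓-R⁻ (Y.tr (inY p) (inY q)) (A.tr (inA p) (inA q))
      ; lb = λ {i} {j} p → trans (⊓-lab y a i)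
               (trans (cong₂ _∧_ (Y.lb (inY p)) (A.lb (inA p))) (sym (⊓-lab y a j))) })
      where
      module Y = Valid (valid-elim {r = y} vy)
      module A = Valid (valid-elim {r = a} va)
      inY : ∀ {i j} → R (y ⊓ a) i j → R y i j
      inY p = proj₁ (⊓-R y a p)
      inA : ∀ {i j} → R (y ⊓ a) i j → R a i j
      inA p = proj₂ (⊓-R y a p)

    ≤-⊓ : ∀ z y a → (z ≤ᵇ (y ⊓ a)) ≡ ((z ≤ᵇ y) ∧ (z ≤ᵇ a))
    ≤-⊓ z y a = T-ext
      (λ p → let P = le-elim {σ = z} {π = y ⊓ a} p in ∧-intro {z ≤ᵇ y} {z ≤ᵇ a}
         (le-intro {σ = z} {π = y} (record { lr = λ q → proj₁ (⊓-R y a (Le.lr P q))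
                                   ; ll = λ q → ∧-fst (subst T (⊓-lab y a _) (Le.ll P q)) }))
         (le-intro {σ = z} {π = a} (record { lr = λ q → proj₂ (⊓-R y a (Le.lr P q))
                                   ; ll = λ q → ∧-snd {lab y _} (subst T (⊓-lab y a _) (Le.ll P q)) })))
      (λ p → let P = le-elim {σ = z} {π = y} (∧-fst p) ; Q = le-elim {σ = z} {π = a} (∧-snd {z ≤ᵇ y} p) in
         le-intro {σ = z} {π = y ⊓ a} (record
           { lr = λ q → ⊓-R⁻ (Le.lr P q) (Le.lr Q q)
           ; ll = λ q → subst T (sym (⊓-lab y a _)) (∧-intro (Le.ll P q) (Le.ll Q q)) }))

    ⊓-absorb : ∀ {y a} → y ≤ₗ a → y ⊓ a ≡ y
    ⊓-absorb {y} {a} y≤a = raw-ext′ (y ⊓ a) y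
      (λ p → proj₁ (⊓-R y a p))
      (λ p → ⊓-R⁻ p (Le.lr Y≤A p))
      (λ i → trans (⊓-lab y a i) (T-ext ∧-fst (λ p → ∧-intro p (Le.ll Y≤A p))))
      where Y≤A = le-elim {σ = y} {π = a} y≤a

    top-R : ∀ i j → R (oneₗ n) i j
    top-R i j = inR (subst T (sym (rel-mk (λ _ _ → true) (λ _ → true) i j)) tt)

    top-lab : ∀ i → lab (oneₗ n) i ≡ true
    top-lab = lab-mk (λ _ _ → true) (λ _ → true)

    top-valid : T (valid (oneₗ n))
    top-valid = valid-intro {r = oneₗ n} (record
      { rf = λ i → top-R i i ; sy = λ _ → top-R _ _ ; tr = λ _ _ → top-R _ _
      ; lb = λ {i} {j} _ → trans (top-lab i) (sym (top-lab j)) })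

    ≤-top : ∀ z → z ≤ₗ oneₗ n
    ≤-top z = le-intro {σ = z} {π = oneₗ n} (record { lr = λ {i} {j} _ → top-R i j ; ll = λ {i} _ → subst T (sym (top-lab i)) tt })

open Constructions

module Blocks (m : ℕ) where
  open import Data.Bool using (_∨_; not; if_then_else_)
  open import Data.Bool.Properties using (∧-identityʳ; ∨-zeroʳ)
  open import Data.Unit using (tt)
  open import Data.Empty using (⊥-elim)
  open import Data.Fin using (Fin; zero; suc) renaming (_≟_ to _≟ᶠ_)
  open import Data.Fin.Properties using (any?)
  open import Data.Product using (Σ)
  open import Data.Sum using (_⊎_; inj₁; inj₂)
  open import Relation.Nullary using (yes; no)
  open import Relation.Nullary.Decidable using (T?; toWitness; fromWitness)

  private
    n : ℕ
    n = suc m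

  -- collapse S sends S to zero and fixes everything else; when S ∋ zero its
  -- fibres are S and the singletons outside S.
  collapse : (Fin n → Bool) → Fin n → Fin n
  collapse S i = if S i then zero else i

  block : Bool → (Fin n → Bool) → Raw n
  block b S = fibres (collapse S) b

  block-R : ∀ {b S} → S zero ≡ true → ∀ {i j} → R (block b S) i j → i ≡ j ⊎ (S i ≡ true × S j ≡ true)
  block-R {b} {S} S0 {i} {j} p = from-collapse (fibres-R (collapse S) b p)
    where
    from-collapse : collapse S i ≡ collapse S j → i ≡ j ⊎ (S i ≡ true × S j ≡ true)
    from-collapse eq with S i in si | S j in sj
    ... | true  | true  = inj₂ (refl , refl)
    ... | true  | false = ⊥-elim (true≢false (trans (sym S0) (trans (cong S eq) sj)))
    ... | false | true  = ⊥-elim (true≢false (trans (sym S0) (trans (cong S (sym eq)) si)))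
    ... | false | false = inj₁ eq

  block-R⁻ : ∀ b S {i j} → i ≡ j ⊎ (S i ≡ true × S j ≡ true) → R (block b S) i j
  block-R⁻ b S {i} (inj₁ refl)  = fibres-R⁻ (collapse S) b {i} refl
  block-R⁻ b S (inj₂ (si , sj)) = fibres-R⁻ (collapse S) b (trans (to-zero si) (sym (to-zero sj)))
    where
    to-zero : ∀ {i} → S i ≡ true → collapse S i ≡ zero
    to-zero si rewrite si = refl

  block-lab : ∀ b S i → lab (block b S) i ≡ b
  block-lab b S = fibres-lab (collapse S) b

  block-valid : ∀ b S → T (valid (block b S))
  block-valid b S = fibres-valid (collapse S) b

  block-cong : ∀ b {S S′} → (∀ i → S i ≡ S′ i) → block b S ≡ block b S′
  block-cong b {S} {S′} e = fibres-cong b (λ i → cong (λ c → if c then zero else i) (e i))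

  block-mono : ∀ b {S S′} → S zero ≡ true → (∀ {i} → S i ≡ true → S′ i ≡ true) → block b S ≤ₗ block b S′
  block-mono b {S} {S′} S0 S⊆S′ = le-intro {σ = block b S} {π = block b S′} (record
    { lr = λ p → block-R⁻ b S′ (enlarge (block-R {b} {S} S0 p))
    ; ll = λ {i} q → subst T (trans (block-lab b S i) (sym (block-lab b S′ i))) q })
    where
    enlarge : ∀ {i j} → i ≡ j ⊎ (S i ≡ true × S j ≡ true) → i ≡ j ⊎ (S′ i ≡ true × S′ j ≡ true)
    enlarge (inj₁ i≡j)       = inj₁ i≡j
    enlarge (inj₂ (si , sj)) = inj₂ (S⊆S′ si , S⊆S′ sj)

  full : Fin n → Bool
  full _ = true

  block-true-full : block true full ≡ oneₗ n
  block-true-full = raw-ext′ (block true full) (oneₗ n)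
    (λ {i} {j} _ → top-R i j) (λ _ → block-R⁻ true full (inj₂ (refl , refl)))
    (λ i → trans (block-lab true full i) (sym (top-lab i)))

  block-false-full≢top : block false full ≢ oneₗ n
  block-false-full≢top eq =
    true≢false (trans (sym (top-lab {n} zero)) (trans (cong (λ z → lab z zero) (sym eq)) (block-lab false full zero)))

  -- Above the unlabelled full block lies only the labelled full block,
  -- since every partition above it has a single block.
  above-block-false-full : ∀ {z} → T (valid z) → block false full ≤ₗ z → z ≡ block false full ⊎ z ≡ oneₗ n
  above-block-false-full {z} vz U≤z = by-label (lab z zero) refl
    where
    Rz : ∀ i j → R z i j
    Rz i j = Le.lr (le-elim {σ = block false full} {π = z} U≤z) (block-R⁻ false full (inj₂ (refl , refl)))
    lab-z : ∀ i → lab z i ≡ lab z zero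
    lab-z i = sym (Valid.lb (valid-elim {r = z} vz) (Rz zero i))
    by-label : ∀ c → lab z zero ≡ c → z ≡ block false full ⊎ z ≡ oneₗ n
    by-label false lz = inj₁ (raw-ext′ z (block false full)
                                       (λ _ → block-R⁻ false full (inj₂ (refl , refl))) (λ _ → Rz _ _)
                                       (λ i → trans (lab-z i) (trans lz (sym (block-lab false full i)))))
    by-label true  lz = inj₂ (raw-ext′ z (oneₗ n) (λ {i} {j} _ → top-R i j) (λ _ → Rz _ _)
                                       (λ i → trans (lab-z i) (trans lz (sym (top-lab i)))))

  insert : (Fin n → Bool) → Fin n → Fin n → Bool
  insert S r i = S i ∨ (i ==ᶠ r)

  insert-old : ∀ S {r i} → S i ≡ true → insert S r i ≡ true
  insert-old S si rewrite si = refl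

  insert-self : ∀ S {r i} → i ≡ r → insert S r i ≡ true
  insert-self S {r} refl = trans (cong (S r ∨_) (T⇒≡ (fromWitness {a? = r ≟ᶠ r} refl))) (∨-zeroʳ (S r))

  insert-new : ∀ S {r i} → S i ≡ false → insert S r i ≡ true → i ≡ r
  insert-new S {r} {i} si q rewrite si = toWitness (≡⇒T q)

  module WeisnerSet (b : Bool) (S : Fin n → Bool) (S0 : S zero ≡ true) where

    x : Raw n
    x = block b S

    a : Raw n
    a = split S

    x≤a : x ≤ₗ a
    x≤a = le-intro {σ = x} {π = a} (record
      { lr = λ p → split-R⁻ S (same-side (block-R {b} {S} S0 p))
      ; ll = λ {i} _ → subst T (sym (split-lab S i)) tt })
      where
      same-side : ∀ {i j} → i ≡ j ⊎ (S i ≡ true × S j ≡ true) → S i ≡ S j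
      same-side (inj₁ refl)      = refl
      same-side (inj₂ (si , sj)) = trans si (sym sj)

    -- Meeting with a keeps the labels, as all blocks of a are labelled.
    ⊓a-lab : ∀ y i → lab (y ⊓ a) i ≡ lab y i
    ⊓a-lab y i = trans (⊓-lab y a i) (trans (cong (lab y i ∧_) (split-lab S i)) (∧-identityʳ (lab y i)))

    x⁺ : Fin n → Raw n
    x⁺ r = block b (insert S r)

    x≤x⁺ : ∀ r → x ≤ₗ x⁺ r
    x≤x⁺ r = block-mono b {S} {insert S r} S0 (insert-old S {r})

    x⁺⊓a : ∀ {r} → S r ≡ false → x⁺ r ⊓ a ≡ x
    x⁺⊓a {r} Sr = raw-ext′ (x⁺ r ⊓ a) x fwd bwd
      (λ i → trans (⊓a-lab (x⁺ r) i) (trans (block-lab b (insert S r) i) (sym (block-lab b S i))))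
      where
      fwd : ∀ {i j} → R (x⁺ r ⊓ a) i j → R x i j
      fwd {i} {j} p with ⊓-R (x⁺ r) a p
      ... | p⁺ , pa with block-R {b} {insert S r} (insert-old S S0) p⁺ | S i in si
      ...   | inj₁ i≡j        | _     = block-R⁻ b S (inj₁ i≡j)
      ...   | inj₂ _          | true  = block-R⁻ b S (inj₂ (si , trans (sym (split-R S pa)) si))
      ...   | inj₂ (ai , aj)  | false =
        block-R⁻ b S (inj₁ (trans (insert-new S si ai) (sym (insert-new S (trans (sym (split-R S pa)) si) aj))))
      bwd : ∀ {i j} → R x i j → R (x⁺ r ⊓ a) i j
      bwd q = ⊓-R⁻ (Le.lr (le-elim {σ = x} {π = x⁺ r} (x≤x⁺ r)) q) (Le.lr (le-elim {σ = x} {π = a} x≤a) q)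

    -- zero and r share a block in x⁺ r but not in x; hence the x⁺ r are
    -- distinct from x and from each other.
    x⁺-links : ∀ r → R (x⁺ r) zero r
    x⁺-links r = block-R⁻ b (insert S r) (inj₂ (insert-old S S0 , insert-self S refl))

    x⁺≢x : ∀ {r} → S r ≡ false → x⁺ r ≢ x
    x⁺≢x {r} Sr eq with block-R {b} {S} S0 (subst (λ z → R z zero r) eq (x⁺-links r))
    ... | inj₁ 0≡r     = true≢false (trans (sym S0) (trans (cong S 0≡r) Sr))
    ... | inj₂ (_ , sr) = true≢false (trans (sym sr) Sr)

    x⁺-injective : ∀ {r r′} → S r ≡ false → x⁺ r ≡ x⁺ r′ → r ≡ r′
    x⁺-injective {r} {r′} Sr eq
      with block-R {b} {insert S r′} (insert-old S S0) (subst (λ z → R z zero r) eq (x⁺-links r))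
    ... | inj₁ 0≡r     = ⊥-elim (true≢false (trans (sym S0) (trans (cong S 0≡r) Sr)))
    ... | inj₂ (_ , ar) = insert-new S Sr ar

    -- Every y in the Weisner set is determined by Z, its block containing zero.
    module Above {y} (vy : T (valid y)) (x≤y : x ≤ₗ y) (y⊓a≡x : y ⊓ a ≡ x) where
      open Valid (valid-elim {r = y} vy)

      Z : Fin n → Bool
      Z i = rel y zero i

      inZ : ∀ {i} → Z i ≡ true → R y zero i
      inZ zi = inR (≡⇒T zi)

      outZ : ∀ {i} → R y zero i → Z i ≡ true
      outZ p = T⇒≡ (outR p)

      S⊆Z : ∀ {i} → S i ≡ true → Z i ≡ true
      S⊆Z si = outZ (Le.lr (le-elim {σ = x} {π = y} x≤y) (block-R⁻ b S (inj₂ (S0 , si))))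

      same-side : ∀ {i j} → S i ≡ S j → R y i j → R x i j
      same-side {i} {j} q p = subst (λ z → R z i j) y⊓a≡x (⊓-R⁻ p (split-R⁻ S q))

      y-lab : ∀ i → lab y i ≡ b
      y-lab i = trans (sym (⊓a-lab y i)) (trans (cong (λ z → lab z i) y⊓a≡x) (block-lab b S i))

      y-is-block : y ≡ block b Z
      y-is-block = raw-ext′ y (block b Z) fwd bwd (λ i → trans (y-lab i) (sym (block-lab b Z i)))
        where
        bwd : ∀ {i j} → R (block b Z) i j → R y i j
        bwd p with block-R {b} {Z} (outZ (rf zero)) p
        ... | inj₁ refl       = rf _
        ... | inj₂ (zi , zj) = tr (sy (inZ zi)) (inZ zj)
        fwd : ∀ {i j} → R y i j → R (block b Z) i j
        fwd {i} {j} p with Z i in zi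
        ... | true = block-R⁻ b Z (inj₂ (zi , outZ (tr (inZ zi) p)))
        ... | false with S i in si | S j in sj
        ...   | true  | _     = ⊥-elim (true≢false (trans (sym (S⊆Z si)) zi))
        ...   | false | true  = ⊥-elim (true≢false (trans (sym (outZ (tr (inZ (S⊆Z sj)) (sy p)))) zi))
        ...   | false | false with block-R {b} {S} S0 (same-side (trans si (sym sj)) p)
        ...     | inj₁ i≡j      = block-R⁻ b Z (inj₁ i≡j)
        ...     | inj₂ (si′ , _) = ⊥-elim (true≢false (trans (sym si′) si))

      Z-cases : (∀ i → Z i ≡ S i) ⊎ Σ (Fin n) λ r → S r ≡ false × (∀ i → Z i ≡ insert S r i)
      Z-cases with any? (λ r → T? (not (S r) ∧ Z r))
      ... | no none = inj₁ λ i → T-ext (Z⊆S i) (λ s → ≡⇒T (S⊆Z (T⇒≡ s)))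
        where
        Z⊆S : ∀ i → T (Z i) → T (S i)
        Z⊆S i zi with S i in si
        ... | true  = tt
        ... | false = ⊥-elim (none (i , ∧-intro {not (S i)} (T-not si) zi))
      ... | yes (r , h) = inj₂ (r , Sr , λ i → T-ext (Z⊆insert i) (insert⊆Z i))
        where
        Sr : S r ≡ false
        Sr = T-not⁻ (∧-fst h)
        Zr : R y zero r
        Zr = inR (∧-snd {not (S r)} h)
        Z⊆insert : ∀ i → T (Z i) → T (insert S r i)
        Z⊆insert i zi with S i in si
        ... | true  = tt
        ... | false with block-R {b} {S} S0 (same-side (trans si (sym Sr)) (tr (sy (inZ (T⇒≡ zi))) Zr))
        ...   | inj₁ i≡r       = fromWitness i≡r
        ...   | inj₂ (si′ , _) = ⊥-elim (true≢false (trans (sym si′) si))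
        insert⊆Z : ∀ i → T (insert S r i) → T (Z i)
        insert⊆Z i q with S i in si
        ... | true  = ≡⇒T (S⊆Z si)
        ... | false with toWitness {a? = i ≟ᶠ r} q
        ...   | refl = outR Zr

    weisner-set : ∀ {y} → T (valid y) → x ≤ₗ y → y ⊓ a ≡ x → y ≡ x ⊎ Σ (Fin n) λ r → S r ≡ false × y ≡ x⁺ r
    weisner-set {y} vy x≤y y⊓a≡x with Above.Z-cases {y} vy x≤y y⊓a≡x
    ... | inj₁ Z≗S            = inj₁ (trans (Above.y-is-block {y} vy x≤y y⊓a≡x) (block-cong b Z≗S))
    ... | inj₂ (r , Sr , Z≗S⁺) = inj₂ (r , Sr , trans (Above.y-is-block {y} vy x≤y y⊓a≡x) (block-cong b Z≗S⁺))

  S₀ : Fin n → Bool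
  S₀ i = i ==ᶠ zero

  singletons-as-block : ∀ b → fibres (λ i → i) b ≡ block b S₀
  singletons-as-block b = fibres-cong {h = λ i → i} {h′ = collapse S₀} b (λ { zero → refl ; (suc i) → refl })

module Computation (m : ℕ) (μ : Raw (suc m) → Raw (suc m) → ℤ) (isMöbius : IsMöbius μ) where
  open import Data.Bool using (not; _∨_)
  open import Data.Bool.Properties using (∨-identityʳ; not-injective)
  open import Data.Nat.Properties using (suc-injective)
  open import Data.Fin using (Fin; zero; suc) renaming (_≟_ to _≟ᶠ_)
  open import Data.Integer.Properties using (pos-*; +-0-abelianGroup)
  open import Data.Integer.Solver using (module +-*-Solver)
  open import Algebra.Bundles using (AbelianGroup)
  open import Algebra.Properties.Group (AbelianGroup.group +-0-abelianGroup) using (inverseˡ-unique)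
  open import Data.List using (allFin)
  open import Data.List.Membership.Propositional.Properties using (∈-allFin)
  import Data.List.Relation.Unary.Unique.Propositional.Properties as Unique
  open import Data.Product using (Σ)
  open import Data.Sum using (inj₁; inj₂)
  open import Data.Empty using (⊥-elim)
  open import Function using (_∘_)
  open import Relation.Nullary using (⌊_⌋)
  open import Relation.Nullary.Decidable using (toWitness; fromWitness; isYes≗does; dec-false)
  open Blocks m

  private
    n : ℕ
    n = suc m

  open IsMöbius isMöbius

  E : List (Raw n)
  E = elements n

  top : Raw n
  top = oneₗ n

  top∈E : top ∈ E
  top∈E = ∈-elements top (top-valid {n})

  open Möbius _≟R_ E (elements-unique n) _≤ᵇ_
    (λ {x} _ → ≤ₗ-refl {x = x})
    (λ {x} {y} {z} _ _ _ → ≤ₗ-trans {x = x} {y = y} {z = z})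
    (λ {x} {y} _ _ → ≤ₗ-antisym {x = x} {y = y})
    μ (λ x∈ → diag _ (elements-valid x∈))
    (λ {x} {y} x∈ y∈ x≤y x≢y →
       trans (sym (∑-filter E (λ z → (x ≤ᵇ z) ∧ (z ≤ᵇ y)) (μ x)))
             (sum0 x y (elements-valid x∈) (elements-valid y∈) x≤y x≢y))

  sign : Bool → ℕ → ℤ
  sign true  k = -1ℤ ^ k
  sign false k = -1ℤ ^ suc k

  val : Bool → ℕ → ℤ
  val b k = sign b k * + (k !)

  negate-step : ∀ s k → (-1ℤ * s) * + (suc k !) ≡ - (+ suc k * (s * + (k !)))
  negate-step s k = trans (cong ((-1ℤ * s) *_) (pos-* (suc k) (k !))) (reassociate s (+ suc k) (+ (k !)))
    where
    open +-*-Solver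
    reassociate : ∀ s c f → (-1ℤ * s) * (c * f) ≡ - (c * (s * f))
    reassociate = solve 3 (λ s c f → (con -1ℤ :* s) :* (c :* f) := :- (c :* (s :* f))) refl

  val-step : ∀ b k → - (+ suc k * val b k) ≡ val b (suc k)
  val-step true  k = sym (negate-step (sign true k) k)
  val-step false k = sym (negate-step (sign false k) k)

  outside : (Fin n → Bool) → ℕ
  outside S = count (not ∘ S) (allFin n)

  -- Base case: the full block, where [block false full, 1̂ₗ] has two elements.
  μ-full : ∀ b → μ (block b full) top ≡ val b 0
  μ-full true  = trans (cong (λ z → μ z top) block-true-full) (diag top (top-valid {n}))
  μ-full false = μ-cover (∈-elements _ (block-valid false full)) top∈E (≤-top {n} (block false full)) block-false-full≢top
                         (λ z∈ U≤z _ → above-block-false-full (elements-valid z∈) U≤z)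

  outside-insert : ∀ {S r} → S r ≡ false → outside S ≡ suc (outside (insert S r))
  outside-insert {S} {r} Sr =
    count-drop (allFin n) (Unique.allFin⁺ n) (∈-allFin r) (cong not Sr) (cong not (insert-self S refl)) unchanged
    where
    unchanged : ∀ {e} → e ∈ allFin n → e ≢ r → not (insert S r e) ≡ not (S e)
    unchanged {e} _ e≢r =
      cong not (trans (cong (S e ∨_) (trans (isYes≗does (e ≟ᶠ r)) (dec-false (e ≟ᶠ r) e≢r))) (∨-identityʳ (S e)))

  -- Weisner's theorem at x = block b S and the coatom a = split S, whose Weisner
  -- set is reindexed by Fin (suc n): zero ↦ x and suc r ↦ x⁺ r for r ∉ S.
  module Recurrence (b : Bool) (S : Fin n → Bool) (S0 : S zero ≡ true) {r₀ : Fin n} (Sr₀ : S r₀ ≡ false) where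
    open WeisnerSet b S S0

    -- a is not the top, as it separates zero from r₀.
    a≢top : a ≢ top
    a≢top eq = true≢false (trans (sym S0) (trans (split-R S (subst (λ z → R z zero r₀) (sym eq) (top-R zero r₀))) Sr₀))

    P : Raw n → Bool
    P y = (x ≤ᵇ y) ∧ ⌊ (y ⊓ a) ≟R x ⌋

    P-intro : ∀ {y} → x ≤ₗ y → y ⊓ a ≡ x → P y ≡ true
    P-intro {y} x≤y eq = T⇒≡ (∧-intro {x ≤ᵇ y} x≤y (fromWitness eq))

    member : Fin (suc n) → Raw n
    member zero    = x
    member (suc r) = x⁺ r

    is-new : Fin (suc n) → Bool
    is-new zero    = true
    is-new (suc r) = not (S r)

    member∈E : ∀ {d} → d ∈ allFin (suc n) → T (is-new d) → member d ∈ E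
    member∈E {zero}  _ _ = ∈-elements x (block-valid b S)
    member∈E {suc r} _ _ = ∈-elements (x⁺ r) (block-valid b (insert S r))

    P-member : ∀ {d} → d ∈ allFin (suc n) → T (is-new d) → P (member d) ≡ true
    P-member {zero}  _ _   = P-intro {x} (≤ₗ-refl {x = x}) (⊓-absorb {y = x} {a = a} x≤a)
    P-member {suc r} _ new = P-intro {x⁺ r} (x≤x⁺ r) (x⁺⊓a (T-not⁻ new))

    P-onto : ∀ {y} → y ∈ E → P y ≡ true → Σ (Fin (suc n)) λ d → d ∈ allFin (suc n) × T (is-new d) × y ≡ member d
    P-onto {y} y∈ Py with weisner-set (elements-valid y∈) (∧-fst (≡⇒T Py)) (toWitness (∧-snd {x ≤ᵇ y} (≡⇒T Py)))
    ... | inj₁ y≡x            = zero , ∈-allFin zero , _ , y≡x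
    ... | inj₂ (r , Sr , y≡x⁺) = suc r , ∈-allFin (suc r) , T-not Sr , y≡x⁺

    member-injective : ∀ {d d′} → T (is-new d) → T (is-new d′) → member d ≡ member d′ → d ≡ d′
    member-injective {zero}  {zero}   _   _    _  = refl
    member-injective {zero}  {suc r}  _   new′ eq = ⊥-elim (x⁺≢x (T-not⁻ new′) (sym eq))
    member-injective {suc r} {zero}   new _    eq = ⊥-elim (x⁺≢x (T-not⁻ new) eq)
    member-injective {suc r} {suc r′} new _    eq = cong suc (x⁺-injective (T-not⁻ new) eq)

    weisner-recurrence : μ x top + ∑ (allFin n) (λ r → ind (not (S r)) (μ (x⁺ r) top)) ≡ 0ℤ
    weisner-recurrence = begin
        μ x top + ∑ (allFin n) (λ r → ind (not (S r)) (μ (x⁺ r) top))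
      ≡⟨ sym (∑-allFin-suc (λ d → ind (is-new d) (μ (member d) top))) ⟩
        ∑ (allFin (suc n)) (λ d → ind (is-new d) (μ (member d) top))
      ≡⟨ sym (∑-reindex _≟R_ E (allFin (suc n)) (elements-unique n) (Unique.allFin⁺ (suc n))
                        (λ y → μ y top) member∈E P-member P-onto member-injective) ⟩
        ∑ E (λ y → ind (P y) (μ y top))
      ≡⟨ Weisner.weisner top top∈E (λ {z} _ → ≤-top z) (∈-elements x (block-valid b S))
           (∈-elements a (split-valid S)) x≤a a≢top (_⊓ a)
           (λ {y} y∈ → ∈-elements (y ⊓ a) (⊓-valid y a (elements-valid y∈) (split-valid S))) (λ {z} {y} _ _ → ≤-⊓ z y a) ⟩
        0ℤ ∎
      where open ≡-Reasoning

  μ-block : ∀ k b {S} → S zero ≡ true → outside S ≡ k → μ (block b S) top ≡ val b k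
  μ-block zero b {S} S0 none =
    trans (cong (λ z → μ z top) (block-cong b (λ i → not-injective (count-zero (allFin n) none (∈-allFin i)))))
          (μ-full b)
  μ-block (suc k) b {S} S0 outside≡ with count-witness (allFin n) outside≡
  ... | r₀ , r₀-outside = begin
      μ x top
    ≡⟨ inverseˡ-unique _ _ weisner-recurrence ⟩
      - ∑ (allFin n) (λ r → ind (not (S r)) (μ (x⁺ r) top))
    ≡⟨ cong -_ (∑-cong (allFin n) by-induction) ⟩
      - ∑ (allFin n) (λ r → ind (not (S r)) (val b k))
    ≡⟨ cong -_ (∑-count (allFin n) (not ∘ S) (val b k)) ⟩
      - (+ outside S * val b k)
    ≡⟨ cong (λ c → - (+ c * val b k)) outside≡ ⟩
      - (+ suc k * val b k)
    ≡⟨ val-step b k ⟩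
      val b (suc k) ∎
    where
    open ≡-Reasoning
    open WeisnerSet b S S0
    open Recurrence b S S0 (not-injective r₀-outside)
    by-induction : ∀ {r} → r ∈ allFin n → ind (not (S r)) (μ (x⁺ r) top) ≡ ind (not (S r)) (val b k)
    by-induction {r} _ with S r in Sr
    ... | true  = refl
    ... | false = μ-block k b (insert-old S S0) (suc-injective (trans (sym (outside-insert Sr)) outside≡))

  μ-singletons : ∀ b → μ (fibres (λ i → i) b) top ≡ val b m
  μ-singletons b = trans (cong (λ z → μ z top) (singletons-as-block b)) (μ-block m b {S₀} refl outside-S₀)
    where
    outside-S₀ : outside S₀ ≡ m
    outside-S₀ = count-tabulate (not ∘ S₀) suc (λ _ → refl)

-- σ_n and 0̂_l are the partitions into singletons labelled true and false.
theorem4p10 : (m : ℕ) (μ : Raw (suc m) → Raw (suc m) → ℤ) → IsMöbius μ →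
    (μ (sigmaₗ (suc m)) (oneₗ (suc m)) ≡ (-1ℤ ^ m) * (+ (m !)))
    × (μ (zeroₗ (suc m)) (oneₗ (suc m)) ≡ (-1ℤ ^ suc m) * (+ (m !)))
theorem4p10 m μ isMöbius = μ-singletons true , μ-singletons false
  where open Computation m μ isMöbius
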